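{- Let $q$ be a prime power, let $f(x)=x^e$ be a permutation polynomial of $\mathrm{GF}(q)$, and let $k\ge 2$ be an integer such that $|\mathcal{B}_{(f,k)}|\ge 1$. Then the incidence structure $\mathbf{D}(f,k)=(\mathrm{GF}(q),\mathcal{B}_{(f,k)})$ is a $2$-$(q,k,\lambda)$ design for some $\lambda$.
   Context: For a polynomial $f$ over $\mathrm{GF}(q)$ (viewed as a function $\mathrm{GF}(q)\to\mathrm{GF}(q)$), for $(b,c)\in\mathrm{GF}(q)^2$ put $B_{(f,b,c)}=\{f(x)+bx+c: x\in \mathrm{GF}(q)\}$. For an integer $k$ with $2\le k\le q$, $\mathcal{B}_{(f,k)}=\{B_{(f,b,c)}: |B_{(f,b,c)}|=k,\ b,c\in\mathrm{GF}(q)\}$ (a set, so each block appears once), and $\mathbf{D}(f,k)$ is the incidence structure with point set $\mathrm{GF}(q)$, block set $\mathcal{B}_{(f,k)}$ and incidence given by membership. A $t$-$(v,k,\lambda)$ design is a pair $(\mathcal{P},\mathcal{B})$ with $|\mathcal{P}|=v$ and $\mathcal{B}$ a set of $k$-subsets of $\mathcal{P}$ such that every $t$-subset of $\mathcal{P}$ is contained in exactly $\lambda$ members of $\mathcal{B}$. -}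

module Defs where

open import Level using (0ℓ)
open import Data.Nat using (ℕ; zero; suc)
open import Data.Fin using (Fin)
open import Data.Fin.Properties using (any?)
open import Data.Fin.Subset using (Subset; ∣_∣; _∈_)
open import Data.Fin.Subset.Properties using (_∈?_)
open import Data.Bool using (Bool)
open import Data.Bool.Properties renaming (_≟_ to _≟ᵇ_)
open import Data.Vec using (tabulate)
open import Data.Vec.Properties using (≡-dec)
open import Data.List using (List; map; filter; length; deduplicate; cartesianProduct)
open import Data.List.Base using (allFin)
open import Data.Product using (_×_; _,_; ∃)
open import Data.Nat using (_≟_)
open import Relation.Nullary using (¬_; Dec; yes; no; ⌊_⌋)
open import Relation.Nullary.Decidable using (_×-dec_)
open import Relation.Binary.PropositionalEquality using (_≡_; _≢_)
import Data.List.Membership.Propositional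
open import Data.List.Relation.Unary.Unique.Propositional using (Unique)
import Data.Product
import Algebra.Structures as S
import Data.Fin.Properties as FinP

-- A field structure whose carrier is Fin q (every finite field of order q
-- is isomorphic to one of these), with propositional equality.
record FieldOn (q : ℕ) : Set where
  infixl 6 _+_
  infixl 7 _*_
  field
    _+_ _*_ : Fin q → Fin q → Fin q
    -_      : Fin q → Fin q
    0# 1#   : Fin q
    isCommutativeRing : S.IsCommutativeRing {A = Fin q} _≡_ _+_ _*_ -_ 0# 1#
    0≢1     : 0# ≢ 1#
    _⁻¹     : Fin q → Fin q
    inverse : ∀ x → x ≢ 0# → x * (x ⁻¹) ≡ 1#

module _ {q : ℕ} (F : FieldOn q) where
  open FieldOn F

  pow : Fin q → ℕ → Fin q
  pow x zero    = 1#
  pow x (suc e) = x * pow x e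

  monomial : ℕ → Fin q → Fin q
  monomial e x = pow x e

  block : (Fin q → Fin q) → Fin q → Fin q → Subset q
  block f b c = tabulate λ y →
    ⌊ any? (λ x → FinP._≟_ (f x + b * x + c) y) ⌋

  blocks : (Fin q → Fin q) → ℕ → List (Subset q)
  blocks f k =
    deduplicate (≡-dec _≟ᵇ_)
      (filter (λ B → ∣ B ∣ ≟ k)
        (map (λ bc → block f (Data.Product.proj₁ bc) (Data.Product.proj₂ bc))
             (cartesianProduct (allFin q) (allFin q))))

Is2Design : (v k λ' : ℕ) → List (Subset v) → Set
Is2Design v k λ' 𝓑 =
  Unique 𝓑 ×
  (∀ B → B Data.List.Membership.Propositional.∈ 𝓑 → ∣ B ∣ ≡ k) ×
  (∀ (i j : Fin v) → i ≢ j →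
     length (filter (λ B → (i ∈? B) ×-dec (j ∈? B)) 𝓑) ≡ λ')

module Submission where

-- The affine maps π(y) = a y + d (a ≠ 0) permute 𝓑: writing
-- a = uᵉ (possible because xᵉ is onto), the substitution x ↦ u x gives
--   π(B_(b,c)) = B_(a b u⁻¹, a c + d),
-- and π preserves sizes.  An automorphism π maps the blocks through
-- {i, j} injectively to the blocks through {π i, π j}, so the number of
-- blocks through a pair can only grow along π.  The affine group is
-- transitive on ordered pairs of distinct points, so all these numbers
-- are equal.

open import Defs
open import Data.Nat using (ℕ; zero; suc; _≤_; z≤n; s≤s; _≟_)
open import Data.Nat.Properties using (≤-antisym; +-0-commutativeMonoid)
open import Data.Fin using (Fin)
open import Data.Fin.Permutation using (Permutation′; _⟨$⟩ʳ_; _⟨$⟩ˡ_; inverseˡ; inverseʳ; flip; permutation)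
open import Data.Fin.Subset using (Subset; ∣_∣; _∈_; _⊆_)
open import Data.Fin.Subset.Properties using (_∈?_; ⊆-antisym)
open import Data.Bool using (Bool; true; false)
open import Data.Bool.Properties using (T-≡) renaming (_≟_ to _≟ᵇ_)
open import Data.Vec using ([]; _∷_; lookup; tabulate)
open import Data.Vec.Properties using (≡-dec; []=⇒lookup; lookup⇒[]=; lookup∘tabulate)
open import Data.List using (List; []; _∷_; map; filter; length; cartesianProduct; allFin)
open import Data.List.Properties using (length-map)
import Data.List.Membership.Propositional as List
open import Data.List.Membership.Propositional.Properties
  using (∈-map⁺; ∈-map⁻; ∈-filter⁺; ∈-filter⁻; ∈-deduplicate⁺; ∈-deduplicate⁻; ∈-cartesianProduct⁺; ∈-allFin)
open import Data.List.Relation.Unary.Any using (here; there)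
import Data.List.Relation.Unary.All as All
open import Data.List.Relation.Unary.AllPairs using (_∷_)
open import Data.List.Relation.Unary.Unique.Propositional using (Unique)
import Data.List.Relation.Unary.Unique.Propositional.Properties as Unique
open import Data.List.Relation.Unary.Unique.DecPropositional.Properties using (deduplicate-!)
open import Data.Product using (∃; ∃₂; _×_; _,_; proj₁; proj₂)
open import Data.Maybe using (nothing)
open import Level using (0ℓ)
open import Algebra.Bundles using (CommutativeRing)
open import Algebra.Properties.CommutativeMonoid.Sum +-0-commutativeMonoid using (sum; sum-cong-≗; sum-permute)
open import Relation.Nullary using (contradiction)
open import Relation.Nullary.Decidable using (_×-dec_; toWitness; fromWitness)
open import Function.Bundles using (Equivalence)
open import Function.Definitions using (Bijective)
open import Relation.Binary.PropositionalEquality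

indicator : Bool → ℕ
indicator true  = 1
indicator false = 0

∣∣≡sum-indicator : ∀ {n} (B : Subset n) → ∣ B ∣ ≡ sum (λ i → indicator (lookup B i))
∣∣≡sum-indicator []          = refl
∣∣≡sum-indicator (true ∷ B)  = cong suc (∣∣≡sum-indicator B)
∣∣≡sum-indicator (false ∷ B) = ∣∣≡sum-indicator B

module _ {n : ℕ} where

  ∈-tabulate⁺ : ∀ (χ : Fin n → Bool) {x} → χ x ≡ true → x ∈ tabulate χ
  ∈-tabulate⁺ χ {x} χx = lookup⇒[]= x (tabulate χ) (trans (lookup∘tabulate χ x) χx)

  ∈-tabulate⁻ : ∀ (χ : Fin n → Bool) {x} → x ∈ tabulate χ → χ x ≡ true
  ∈-tabulate⁻ χ {x} x∈ = trans (sym (lookup∘tabulate χ x)) ([]=⇒lookup x∈)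

  image : Permutation′ n → Subset n → Subset n
  image π B = tabulate (λ y → lookup B (π ⟨$⟩ˡ y))

  ∈-image⁺ : ∀ π {B x} → x ∈ B → π ⟨$⟩ʳ x ∈ image π B
  ∈-image⁺ π {B} x∈B = ∈-tabulate⁺ _ (trans (cong (lookup B) (inverseˡ π)) ([]=⇒lookup x∈B))

  ∈-image⁻ : ∀ π {B y} → y ∈ image π B → π ⟨$⟩ˡ y ∈ B
  ∈-image⁻ π {B} {y} y∈ = lookup⇒[]= _ B (∈-tabulate⁻ _ y∈)

  -- Sizes are invariant under permutations, as sums are invariant under
  -- reindexing.
  ∣image∣ : ∀ π (B : Subset n) → ∣ image π B ∣ ≡ ∣ B ∣
  ∣image∣ π B = begin
    ∣ image π B ∣                                   ≡⟨ ∣∣≡sum-indicator (image π B) ⟩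
    sum (λ y → indicator (lookup (image π B) y))     ≡⟨ sum-cong-≗ (λ y → cong indicator (lookup∘tabulate (λ y → lookup B (π ⟨$⟩ˡ y)) y)) ⟩
    sum (λ y → indicator (lookup B (π ⟨$⟩ˡ y)))      ≡⟨ sum-permute (λ x → indicator (lookup B x)) (flip π) ⟨
    sum (λ x → indicator (lookup B x))               ≡⟨ ∣∣≡sum-indicator B ⟨
    ∣ B ∣                                           ∎
    where open ≡-Reasoning

  image-injective : ∀ π {B C} → image π B ≡ image π C → B ≡ C
  image-injective π eq = ⊆-antisym (image-reflects-⊆ eq) (image-reflects-⊆ (sym eq))
    where
      image-reflects-⊆ : ∀ {B C} → image π B ≡ image π C → B ⊆ C
      image-reflects-⊆ {C = C} eq {x} x∈B =
        subst (_∈ C) (inverseˡ π) (∈-image⁻ π (subst (π ⟨$⟩ʳ x ∈_) eq (∈-image⁺ π x∈B)))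

module _ {A : Set} where

  delete : ∀ {x : A} (ys : List A) → x List.∈ ys →
    ∃ λ ys′ → length ys ≡ suc (length ys′) × (∀ {z} → z List.∈ ys → z ≢ x → z List.∈ ys′)
  delete (y ∷ ys) (here refl) = ys , refl , keep
    where
      keep : ∀ {z} → z List.∈ (y ∷ ys) → z ≢ y → z List.∈ ys
      keep (here z≡y) z≢y = contradiction z≡y z≢y
      keep (there z∈ys) _ = z∈ys
  delete {x} (y ∷ ys) (there x∈ys) with delete ys x∈ys
  ... | ys′ , len , keep′ = y ∷ ys′ , cong suc len , keep
    where
      keep : ∀ {z} → z List.∈ (y ∷ ys) → z ≢ x → z List.∈ (y ∷ ys′)
      keep (here z≡y)   _   = here z≡y
      keep (there z∈ys) z≢x = there (keep′ z∈ys z≢x)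

  unique-length-≤ : ∀ {xs ys : List A} → Unique xs → (∀ {z} → z List.∈ xs → z List.∈ ys) →
    length xs ≤ length ys
  unique-length-≤ {[]}     _            _     = z≤n
  unique-length-≤ {x ∷ xs} {ys} (x∉xs ∷ uniq) xs⊆ys with delete ys (xs⊆ys (here refl))
  ... | ys′ , len , keep = subst (suc (length xs) ≤_) (sym len)
    (s≤s (unique-length-≤ uniq (λ z∈xs → keep (xs⊆ys (there z∈xs)) (λ z≡x → All.lookup x∉xs z∈xs (sym z≡x)))))

module _ {n : ℕ} where

  pairCount : Fin n → Fin n → List (Subset n) → ℕ
  pairCount i j 𝓑 = length (filter (λ B → (i ∈? B) ×-dec (j ∈? B)) 𝓑)

  IsAutomorphism : Permutation′ n → List (Subset n) → Set
  IsAutomorphism π 𝓑 = ∀ {B} → B List.∈ 𝓑 → image π B List.∈ 𝓑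

  -- An automorphism maps the blocks through {i, j} injectively into the
  -- blocks through {π i, π j}.
  pairCount-≤ : ∀ π {𝓑} → Unique 𝓑 → IsAutomorphism π 𝓑 → ∀ i j →
    pairCount i j 𝓑 ≤ pairCount (π ⟨$⟩ʳ i) (π ⟨$⟩ʳ j) 𝓑
  pairCount-≤ π {𝓑} uniq automorphism i j =
    subst (_≤ pairCount (π ⟨$⟩ʳ i) (π ⟨$⟩ʳ j) 𝓑) (length-map (image π) through)
      (unique-length-≤ (Unique.map⁺ (image-injective π) (Unique.filter⁺ _ uniq)) imageThrough)
    where
      through = filter (λ B → (i ∈? B) ×-dec (j ∈? B)) 𝓑

      imageThrough : ∀ {C} → C List.∈ map (image π) through →
        C List.∈ filter (λ B → (π ⟨$⟩ʳ i ∈? B) ×-dec (π ⟨$⟩ʳ j ∈? B)) 𝓑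
      imageThrough C∈ with ∈-map⁻ (image π) C∈
      ... | B , B∈through , refl with ∈-filter⁻ _ {xs = 𝓑} B∈through
      ... | B∈𝓑 , i∈B , j∈B = ∈-filter⁺ _ (automorphism B∈𝓑) (∈-image⁺ π i∈B , ∈-image⁺ π j∈B)

  TwoTransitive : List (Subset n) → Set
  TwoTransitive 𝓑 = ∀ {i j i′ j′} → i ≢ j → i′ ≢ j′ →
    ∃ λ π → π ⟨$⟩ʳ i ≡ i′ × π ⟨$⟩ʳ j ≡ j′ × IsAutomorphism π 𝓑

  pairCount-≤-of-TwoTransitive : ∀ {𝓑} → Unique 𝓑 → TwoTransitive 𝓑 →
    ∀ {i j i′ j′} → i ≢ j → i′ ≢ j′ → pairCount i j 𝓑 ≤ pairCount i′ j′ 𝓑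
  pairCount-≤-of-TwoTransitive uniq transitive {i} {j} i≢j i′≢j′ with transitive i≢j i′≢j′
  ... | π , refl , refl , automorphism = pairCount-≤ π uniq automorphism i j

  design-of-TwoTransitive : ∀ {k 𝓑} → Unique 𝓑 → (∀ {B} → B List.∈ 𝓑 → ∣ B ∣ ≡ k) →
    TwoTransitive 𝓑 → ∀ {i₀ j₀} → i₀ ≢ j₀ → Is2Design n k (pairCount i₀ j₀ 𝓑) 𝓑
  design-of-TwoTransitive uniq size transitive i₀≢j₀ =
    uniq , (λ _ → size) , λ i j i≢j →
      ≤-antisym (pairCount-≤-of-TwoTransitive uniq transitive i≢j i₀≢j₀)
                (pairCount-≤-of-TwoTransitive uniq transitive i₀≢j₀ i≢j)

module FieldFacts {q : ℕ} (F : FieldOn q) where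
  open FieldOn F

  commutativeRing : CommutativeRing 0ℓ 0ℓ
  commutativeRing = record { isCommutativeRing = isCommutativeRing }

  open CommutativeRing commutativeRing
    using (+-assoc; +-comm; +-identityʳ; -‿inverseˡ; -‿inverseʳ; *-assoc; *-comm; *-identityˡ; *-identityʳ; zeroˡ; distribˡ)
  open import Algebra.Properties.Ring (CommutativeRing.ring commutativeRing) using (-‿distribʳ-*)
  open import Algebra.Solver.Ring.NaturalCoefficients (CommutativeRing.commutativeSemiring commutativeRing) (λ _ _ → nothing)
  open ≡-Reasoning

  infixl 6 _-_
  _-_ : Fin q → Fin q → Fin q
  x - y = x + - y

  sub-add : ∀ y d → y - d + d ≡ y
  sub-add y d = begin
    y - d + d      ≡⟨ +-assoc y (- d) d ⟩
    y + (- d + d)  ≡⟨ cong (y +_) (-‿inverseˡ d) ⟩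
    y + 0#         ≡⟨ +-identityʳ y ⟩
    y              ∎

  add-sub : ∀ y d → y + d - d ≡ y
  add-sub y d = begin
    y + d - d      ≡⟨ +-assoc y d (- d) ⟩
    y + (d - d)    ≡⟨ cong (y +_) (-‿inverseʳ d) ⟩
    y + 0#         ≡⟨ +-identityʳ y ⟩
    y              ∎

  sub≢0 : ∀ {i j} → i ≢ j → j - i ≢ 0#
  sub≢0 {i} {j} i≢j j-i≡0 = i≢j (sym (begin
    j            ≡⟨ sub-add j i ⟨
    j - i + i    ≡⟨ cong (_+ i) j-i≡0 ⟩
    0# + i       ≡⟨ +-comm 0# i ⟩
    i + 0#       ≡⟨ +-identityʳ i ⟩
    i            ∎))

  ⁻¹-inverseˡ : ∀ {a} → a ≢ 0# → a ⁻¹ * a ≡ 1#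
  ⁻¹-inverseˡ {a} a≢0 = trans (*-comm (a ⁻¹) a) (inverse a a≢0)

  ⁻¹-cancelˡ : ∀ {a} → a ≢ 0# → ∀ z → a ⁻¹ * (a * z) ≡ z
  ⁻¹-cancelˡ {a} a≢0 z = begin
    a ⁻¹ * (a * z)   ≡⟨ *-assoc (a ⁻¹) a z ⟨
    a ⁻¹ * a * z     ≡⟨ cong (_* z) (⁻¹-inverseˡ a≢0) ⟩
    1# * z           ≡⟨ *-identityˡ z ⟩
    z                ∎

  ⁻¹-cancelʳ : ∀ {a} → a ≢ 0# → ∀ z → a * (a ⁻¹ * z) ≡ z
  ⁻¹-cancelʳ {a} a≢0 z = begin
    a * (a ⁻¹ * z)   ≡⟨ *-assoc a (a ⁻¹) z ⟨
    a * a ⁻¹ * z     ≡⟨ cong (_* z) (inverse a a≢0) ⟩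
    1# * z           ≡⟨ *-identityˡ z ⟩
    z                ∎

  pow-* : ∀ u x e → pow F (u * x) e ≡ pow F u e * pow F x e
  pow-* u x zero    = sym (*-identityˡ 1#)
  pow-* u x (suc e) = begin
    u * x * pow F (u * x) e                ≡⟨ cong (u * x *_) (pow-* u x e) ⟩
    u * x * (pow F u e * pow F x e)        ≡⟨ solve 4 (λ u x U X → (u :* x) :* (U :* X) := (u :* U) :* (x :* X)) refl u x (pow F u e) (pow F x e) ⟩
    u * pow F u e * (x * pow F x e)        ∎

  pow-0# : ∀ e → e ≢ 0 → pow F 0# e ≡ 0#
  pow-0# zero    e≢0 = contradiction refl e≢0
  pow-0# (suc e) _   = zeroˡ (pow F 0# e)

  affine : (a d : Fin q) → a ≢ 0# → Permutation′ q
  affine a d a≢0 = permutation (λ y → a * y + d) (λ y → a ⁻¹ * (y - d))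
    (λ y → trans (cong (_+ d) (⁻¹-cancelʳ a≢0 (y - d))) (sub-add y d))
    (λ y → trans (cong (a ⁻¹ *_) (add-sub (a * y) d)) (⁻¹-cancelˡ a≢0 y))

  -- The affine group is transitive on ordered pairs of distinct points:
  -- the line through (i, i′) and (j, j′) has slope a ≠ 0.
  affine-through : ∀ {i j i′ j′} → i ≢ j → i′ ≢ j′ →
    ∃₂ λ a d → a ≢ 0# × a * i + d ≡ i′ × a * j + d ≡ j′
  affine-through {i} {j} {i′} {j′} i≢j i′≢j′ = a , i′ - a * i , a≢0 , through-i , through-j
    where
      a = (j′ - i′) * (j - i) ⁻¹

      slope : a * (j - i) ≡ j′ - i′
      slope = begin
        (j′ - i′) * (j - i) ⁻¹ * (j - i)    ≡⟨ *-assoc (j′ - i′) _ _ ⟩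
        (j′ - i′) * ((j - i) ⁻¹ * (j - i))  ≡⟨ cong ((j′ - i′) *_) (⁻¹-inverseˡ (sub≢0 i≢j)) ⟩
        (j′ - i′) * 1#                      ≡⟨ *-identityʳ (j′ - i′) ⟩
        j′ - i′                             ∎

      a≢0 : a ≢ 0#
      a≢0 a≡0 = sub≢0 i′≢j′ (trans (sym slope) (trans (cong (_* (j - i)) a≡0) (zeroˡ (j - i))))

      through-i : a * i + (i′ - a * i) ≡ i′
      through-i = trans (+-comm (a * i) (i′ - a * i)) (sub-add i′ (a * i))

      through-j : a * j + (i′ - a * i) ≡ j′
      through-j = begin
        a * j + (i′ - a * i)      ≡⟨ solve 3 (λ x y z → x :+ (y :+ z) := x :+ z :+ y) refl (a * j) i′ (- (a * i)) ⟩
        a * j - a * i + i′        ≡⟨ cong (λ t → a * j + t + i′) (-‿distribʳ-* a i) ⟩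
        a * j + a * - i + i′      ≡⟨ cong (_+ i′) (distribˡ a j (- i)) ⟨
        a * (j - i) + i′          ≡⟨ cong (_+ i′) slope ⟩
        j′ - i′ + i′              ≡⟨ sub-add j′ i′ ⟩
        j′                        ∎

  -- Substituting u x for x (u ≠ 0) turns an affine image of xᵉ + b x + c
  -- into a polynomial of the same shape: with a = uᵉ,
  --   a (xᵉ + b x + c) + d = (u x)ᵉ + (a b u⁻¹)(u x) + (a c + d).
  affine-monomial : ∀ e {u} → u ≢ 0# → ∀ b c d x →
    pow F u e * (pow F x e + b * x + c) + d
      ≡ pow F (u * x) e + pow F u e * b * u ⁻¹ * (u * x) + (pow F u e * c + d)
  affine-monomial e {u} u≢0 b c d x = begin
    a * (X + b * x + c) + d
      ≡⟨ solve 6 (λ a X b x c d → a :* (X :+ b :* x :+ c) :+ d := a :* X :+ a :* b :* x :+ (a :* c :+ d))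
               refl a X b x c d ⟩
    a * X + a * b * x + (a * c + d)
      ≡⟨ cong₂ (λ s t → s + t + (a * c + d)) (pow-* u x e) rescale ⟨
    pow F (u * x) e + a * b * u ⁻¹ * (u * x) + (a * c + d) ∎
    where
      a = pow F u e
      X = pow F x e

      rescale : a * b * u ⁻¹ * (u * x) ≡ a * b * x
      rescale = trans (*-assoc (a * b) (u ⁻¹) (u * x)) (cong (a * b *_) (⁻¹-cancelˡ u≢0 x))

module BlockMembership {q : ℕ} (F : FieldOn q) (f : Fin q → Fin q) where
  open FieldOn F

  ∈-block⁺ : ∀ {b c y} x → f x + b * x + c ≡ y → y ∈ block F f b c
  ∈-block⁺ x eq = ∈-tabulate⁺ _ (Equivalence.to T-≡ (fromWitness (x , eq)))

  ∈-block⁻ : ∀ {b c y} → y ∈ block F f b c → ∃ λ x → f x + b * x + c ≡ y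
  ∈-block⁻ y∈ = toWitness (Equivalence.from T-≡ (∈-tabulate⁻ _ y∈))

  ∈-blocks⁺ : ∀ {k} b c → ∣ block F f b c ∣ ≡ k → block F f b c List.∈ blocks F f k
  ∈-blocks⁺ {k} b c size = ∈-deduplicate⁺ (≡-dec _≟ᵇ_)
    (∈-filter⁺ (λ B → ∣ B ∣ ≟ k) (∈-map⁺ _ (∈-cartesianProduct⁺ (∈-allFin b) (∈-allFin c))) size)

  ∈-blocks⁻ : ∀ {k B} → B List.∈ blocks F f k → (∃₂ λ b c → B ≡ block F f b c) × ∣ B ∣ ≡ k
  ∈-blocks⁻ {k} B∈ with ∈-filter⁻ (λ B → ∣ B ∣ ≟ k) (∈-deduplicate⁻ (≡-dec _≟ᵇ_) _ B∈)
  ... | B∈all , size with ∈-map⁻ _ {xs = cartesianProduct (allFin q) (allFin q)} B∈all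
  ... | (b , c) , _ , B≡ = (b , c , B≡) , size

  blocks-unique : ∀ k → Unique (blocks F f k)
  blocks-unique k = deduplicate-! (≡-dec _≟ᵇ_) _

module MonomialBlocks {q : ℕ} (F : FieldOn q) (e : ℕ) (bij : Bijective _≡_ _≡_ (monomial F e)) where
  open FieldOn F
  open FieldFacts F
  open BlockMembership F (monomial F e)

  -- x⁰ = 1 is constant, hence not injective since 0 ≠ 1.
  exponent≢0 : e ≢ 0
  exponent≢0 refl = 0≢1 (proj₁ bij refl)

  -- Since 0ᵉ = 0, a nonzero power has a nonzero base.
  root≢0 : ∀ {u} → pow F u e ≢ 0# → u ≢ 0#
  root≢0 uᵉ≢0 refl = uᵉ≢0 (pow-0# e exponent≢0)

  -- Multiplying the argument by u (with a = uᵉ) maps B_(f,b,c) onto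
  -- its affine image, which is the block B_(f, a b u⁻¹, a c + d).
  affine-image-block : ∀ {u} d (uᵉ≢0 : pow F u e ≢ 0#) b c →
    image (affine (pow F u e) d uᵉ≢0) (block F (monomial F e) b c)
      ≡ block F (monomial F e) (pow F u e * b * u ⁻¹) (pow F u e * c + d)
  affine-image-block {u} d uᵉ≢0 b c = ⊆-antisym into onto
    where
      open ≡-Reasoning
      a = pow F u e
      π = affine a d uᵉ≢0
      u≢0 = root≢0 uᵉ≢0
      B = block F (monomial F e) b c
      B′ = block F (monomial F e) (a * b * u ⁻¹) (a * c + d)

      into : image π B ⊆ B′
      into {y} y∈ with ∈-block⁻ (∈-image⁻ π y∈)
      ... | x , eq = ∈-block⁺ (u * x) (begin
        pow F (u * x) e + a * b * u ⁻¹ * (u * x) + (a * c + d) ≡⟨ affine-monomial e u≢0 b c d x ⟨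
        π ⟨$⟩ʳ (pow F x e + b * x + c)                          ≡⟨ cong (π ⟨$⟩ʳ_) eq ⟩
        π ⟨$⟩ʳ (π ⟨$⟩ˡ y)                                       ≡⟨ inverseʳ π ⟩
        y                                                      ∎)

      onto : B′ ⊆ image π B
      onto {y} y∈ with ∈-block⁻ y∈
      ... | z , eq = subst (_∈ image π B) π-x≡y (∈-image⁺ π (∈-block⁺ x refl))
        where
          x = u ⁻¹ * z

          π-x≡y : π ⟨$⟩ʳ (pow F x e + b * x + c) ≡ y
          π-x≡y = begin
            π ⟨$⟩ʳ (pow F x e + b * x + c)                         ≡⟨ affine-monomial e u≢0 b c d x ⟩
            pow F (u * x) e + a * b * u ⁻¹ * (u * x) + (a * c + d) ≡⟨ cong (λ t → pow F t e + a * b * u ⁻¹ * t + (a * c + d)) (⁻¹-cancelʳ u≢0 z) ⟩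
            pow F z e + a * b * u ⁻¹ * z + (a * c + d)             ≡⟨ eq ⟩
            y                                                      ∎

  -- Affine maps are automorphisms of 𝓑_(f,k): every a ≠ 0 is an e-th power.
  affine-preserves-blocks : ∀ {k a d} (a≢0 : a ≢ 0#) → IsAutomorphism (affine a d a≢0) (blocks F (monomial F e) k)
  affine-preserves-blocks {k} {a} {d} a≢0 B∈ with ∈-blocks⁻ B∈ | proj₂ bij a
  ... | (b , c , refl) , size | u , uᵉ≡a with uᵉ≡a refl
  ... | refl = subst (List._∈ blocks F (monomial F e) k) (sym image≡block) (∈-blocks⁺ _ _ size′)
    where
      B = block F (monomial F e) b c
      image≡block = affine-image-block d a≢0 b c

      size′ : ∣ block F (monomial F e) (a * b * u ⁻¹) (a * c + d) ∣ ≡ k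
      size′ = trans (cong ∣_∣ (sym image≡block)) (trans (∣image∣ (affine a d a≢0) B) size)

mainTheorem4 : (q : ℕ) (F : FieldOn q) (e k : ℕ) →
    Bijective _≡_ _≡_ (monomial F e) →
    2 ≤ k → k ≤ q →
    1 ≤ length (blocks F (monomial F e) k) →
    ∃ λ λ' → Is2Design q k λ' (blocks F (monomial F e) k)
mainTheorem4 q F e k bij _ _ _ =
  _ , design-of-TwoTransitive (blocks-unique k) (λ B∈ → proj₂ (∈-blocks⁻ B∈)) transitive 0≢1
  where
    open FieldOn F
    open FieldFacts F
    open BlockMembership F (monomial F e)
    open MonomialBlocks F e bij

    transitive : TwoTransitive (blocks F (monomial F e) k)
    transitive i≢j i′≢j′ with affine-through i≢j i′≢j′
    ... | a , d , a≢0 , maps-i , maps-j = affine a d a≢0 , maps-i , maps-j , affine-preserves-blocks a≢0
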